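{- Let $T$ be a spanning tree of $K_n$. For each edge $e$ of $K_n$, let $A_e$ be the event that $e$ belongs to a spanning tree of $K_n$ drawn uniformly at random. Then the line graph $\mathcal{L}(T)$ is a negative dependency graph for the events $\{A_e\}_{e \in T}$.
   Context: For events $A_1,\dots,A_N$, a negative dependency graph is a simple graph $G=([N],E)$ such that for every $i \in [N]$ and every $S \subseteq \{j \in [N] : \{i,j\} \notin E\}$, if $\Pr[\bigwedge_{j\in S}\bar{A}_j] \neq 0$ then $\Pr[A_i \mid \bigwedge_{j\in S}\bar A_j] \leq \Pr[A_i]$. The line graph $\mathcal{L}(T)$ has vertex set the edges of $T$, two edges adjacent if they share an endpoint. -}

module Defs where

open import Data.Bool using (Bool; true; false; _∧_; _∨_; not; if_then_else_)
open import Data.Nat using (ℕ; zero; suc; _∸_; _<ᵇ_; _≡ᵇ_)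
open import Data.Fin using (Fin; toℕ)
open import Data.Fin.Properties using (_≟_)
open import Data.Fin.Subset using (Subset; _∈_; _⊆_; ∣_∣)
open import Data.List using (List; []; _∷_; _++_; map; filter; length; concatMap; allFin; lookup)
open import Data.Bool.ListAction using (any; all)
open import Data.Vec using (Vec; []; _∷_)
import Data.Vec as Vec
open import Data.Product using (_×_; _,_; proj₁; proj₂)
open import Data.Integer using (+_)
open import Data.Rational using (ℚ; _/_; 0ℚ; _≤_)
open import Relation.Nullary.Decidable using (⌊_⌋)
open import Relation.Binary.PropositionalEquality using (_≡_; _≢_)

-- a / b as a rational number (0 when b = 0; only used with b > 0).
frac : ℕ → ℕ → ℚ
frac a zero    = 0ℚ
frac a (suc b) = (+ a) / suc b

count : {Ω : Set} → List Ω → (Ω → Bool) → ℕ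
count space E = length (filter (λ ω → Data.Bool._≟_ (E ω) true) space)
  where import Data.Bool

Pr : {Ω : Set} → List Ω → (Ω → Bool) → ℚ
Pr space E = frac (count space E) (length space)

PrCond : {Ω : Set} → List Ω → (Ω → Bool) → (Ω → Bool) → ℚ
PrCond space E F = frac (count space (λ ω → E ω ∧ F ω)) (count space F)

noneOf : {Ω : Set} {N : ℕ} → (Fin N → Ω → Bool) → Subset N → Ω → Bool
noneOf {N = N} A S ω = all (λ j → not (Vec.lookup S j ∧ A j ω)) (allFin N)

IsNegDepGraph : {Ω : Set} → List Ω → {N : ℕ} → (V : Subset N) →
                (A : Fin N → Ω → Bool) → (adj : Fin N → Fin N → Bool) → Set
IsNegDepGraph space {N} V A adj =
  ∀ (i : Fin N) → i ∈ V →
  ∀ (S : Subset N) → S ⊆ V → (∀ j → j ∈ S → adj i j ≡ false) →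
  Pr space (noneOf A S) ≢ 0ℚ →
  PrCond space (A i) (noneOf A S) ≤ Pr space (A i)

edgeList : (n : ℕ) → List (Fin n × Fin n)
edgeList n = concatMap (λ u → map (λ v → (u , v))
                 (filter (λ v → toℕ u Data.Nat.<? toℕ v) (allFin n))) (allFin n)
  where import Data.Nat

m : ℕ → ℕ
m n = length (edgeList n)

Edge : ℕ → Set
Edge n = Fin (m n)

ends : {n : ℕ} → Edge n → Fin n × Fin n
ends {n} e = lookup (edgeList n) e

-- a subgraph of K_n (spanning: all vertices) = a subset of its edges
EdgeSet : ℕ → Set
EdgeSet n = Subset (m n)

eqF : {n : ℕ} → Fin n → Fin n → Bool
eqF u v = ⌊ u ≟ v ⌋

adjacent : {n : ℕ} → EdgeSet n → Fin n → Fin n → Bool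
adjacent {n} F u v = any (λ e → Vec.lookup F e ∧
   ((eqF (proj₁ (ends {n} e)) u ∧ eqF (proj₂ (ends {n} e)) v) ∨
    (eqF (proj₁ (ends {n} e)) v ∧ eqF (proj₂ (ends {n} e)) u))) (allFin (m n))

reach : {n : ℕ} → EdgeSet n → ℕ → Fin n → Fin n → Bool
reach F zero    u v = eqF u v
reach {n} F (suc k) u v = reach {n} F k u v ∨
  any (λ w → reach {n} F k u w ∧ adjacent {n} F w v) (allFin n)

-- the graph (Fin n, F) is connected (walks of length ≤ n suffice)
connected : {n : ℕ} → EdgeSet n → Bool
connected {n} F = all (λ u → all (λ v → reach {n} F n u v) (allFin n)) (allFin n)

isSpanningTree : {n : ℕ} → EdgeSet n → Bool
isSpanningTree {n} F = connected {n} F ∧ (∣ F ∣ ≡ᵇ (n ∸ 1))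

allSubsets : (k : ℕ) → List (Subset k)
allSubsets zero    = [] ∷ []
allSubsets (suc k) = map (true ∷_) (allSubsets k) ++ map (false ∷_) (allSubsets k)

spanningTrees : (n : ℕ) → List (EdgeSet n)
spanningTrees n = filter (λ F → Data.Bool._≟_ (isSpanningTree {n} F) true) (allSubsets (m n))
  where import Data.Bool

A : {n : ℕ} → Edge n → EdgeSet n → Bool
A e F = Vec.lookup F e

-- adjacency in the line graph L(T) (restricted to edges of T via the
-- vertex set T): distinct edges sharing an endpoint
lineAdj : {n : ℕ} → Edge n → Edge n → Bool
lineAdj {n} e f = not (eqF e f) ∧
  (eqF (proj₁ (ends {n} e)) (proj₁ (ends {n} f)) ∨ eqF (proj₁ (ends {n} e)) (proj₂ (ends {n} f)) ∨
   eqF (proj₂ (ends {n} e)) (proj₁ (ends {n} f)) ∨ eqF (proj₂ (ends {n} e)) (proj₂ (ends {n} f)))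

-- Fix an edge i = {a, b} of K_n and an event E that depends only on the edges sharing no
-- endpoint with i.  Pairs (t , x) of a spanning tree t ∋ i satisfying E and a vertex x correspond
-- bijectively to pairs (t′ , c) of a spanning tree t′ satisfying E and a Boolean c.  Deleting i
-- splits t into the component of a and the component of b; if x lies in the component of b,
-- replace i by the edge {a, x} and let c = true, otherwise replace i by {b, x} and let c = false.
-- The new edge meets i, so E is unaffected; t is recovered from t′ by exchanging back the last
-- edge at a (resp. b) on the path from a to b (resp. from b to a) in t′.  Hence
-- #{t ∋ i : E t} · n = #{t : E t} · 2, so Pr[A_i | E] = 2/n = Pr[A_i] whenever Pr[E] ≠ 0.
-- If i ∉ S and no edge of S meets i, the event ⋀_{j∈S} ¬A_j is such an E; if i ∈ S, then
-- Pr[A_i | ⋀_{j∈S} ¬A_j] = 0.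

module Submission where

open import Defs

open import Level using (0ℓ)
open import Function using (_∘_; id; case_of_)
open import Function.Bundles using (Equivalence; mk⇔)
open import Relation.Nullary using (¬_; Dec; yes; no)
open import Relation.Nullary.Decidable using (_×-dec_; ¬?)
open import Relation.Binary.Core using (Rel; _⇒_)
open import Relation.Binary.Definitions using (DecidableEquality; tri<; tri≈; tri>)
open import Relation.Binary.PropositionalEquality using (_≡_; _≢_; refl; sym; trans; cong; cong₂; subst; module ≡-Reasoning)
open import Relation.Binary.Construct.Closure.ReflexiveTransitive using (Star; ε; _◅_; _◅◅_)
import Relation.Binary.Construct.Closure.ReflexiveTransitive as Star
open import Data.Empty using (⊥; ⊥-elim)
open import Data.Product using (∃; ∃₂; _×_; _,_; proj₁; proj₂; uncurry)
import Data.Product as Product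
open import Data.Product.Properties using (,-injective)
open import Data.Sum using (_⊎_; inj₁; inj₂)
import Data.Sum as Sum
open import Data.Bool using (Bool; true; false; _∧_; _∨_; not)
open import Data.Bool using () renaming (_≟_ to _≟ᵇ_)
open import Data.Bool.Properties using (T-≡; ¬-not; not-¬; ∧-identityʳ; ∧-conicalˡ; ∧-conicalʳ; ∨-zeroʳ; ∨-conicalˡ; ∨-conicalʳ)
open import Data.Bool.ListAction using (any; all; and)
open import Data.Nat using (ℕ; zero; suc; _+_; _*_; _∸_; _≤_; _<_; _<?_; z≤n; s≤s; _≤′_; ≤′-refl; ≤′-step; NonZero)
open import Data.Nat.Properties using (≤-refl; ≤-reflexive; ≤-trans; ≤-pred; <-irrefl; <-asym; n≮n; 1+n≰n; ≰⇒>; ≤⇒≤′; m≤n⇒m≤1+n; m∸n+n≡m; +-comm; *-assoc; *-cancelʳ-≡; *-commutativeSemigroup; ≡ᵇ⇒≡; ≡⇒≡ᵇ; module ≤-Reasoning)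
open import Algebra.Properties.CommutativeSemigroup *-commutativeSemigroup using (x∙yz≈y∙xz)
open import Data.Integer using (+_)
open import Data.Integer.Properties using (pos-*)
open import Data.Rational using (0ℚ)
import Data.Rational as ℚ
import Data.Rational.Properties as ℚᴾ
import Data.Rational.Unnormalised as ℚᵘ
open import Data.Fin using (Fin; zero; suc; toℕ; punchIn)
open import Data.Fin.Properties using (_≟_; <-cmp; any?; punchIn-injective; punchInᵢ≢i)
open import Data.Fin.Subset using (Subset; _⊆_; ∣_∣) renaming (_∈_ to _∈ˢ_; _∉_ to _∉ˢ_)
open import Data.Fin.Subset.Properties using (_∈?_; p⊂q⇒∣p∣<∣q∣; ∣p∣≤n)
open import Data.Vec using ([]; _∷_; _[_]≔_)
import Data.Vec as Vec
open import Data.Vec.Properties using (∷-injectiveʳ; lookup⇒[]=; []=⇒lookup; lookup∘tabulate; tabulate∘lookup; lookup∘update; lookup∘update′; []≔-updates; []≔-minimal; []≔-idempotent; []≔-lookup)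
open import Data.List using (List; []; _∷_; _++_; map; filter; length; cartesianProduct; tabulate; allFin)
import Data.List as List
open import Data.List.Properties using (length-++; length-map; length-filter; length-tabulate; filter-all; filter-none; map-cong)
open import Data.List.Membership.Propositional using (_∈_)
open import Data.List.Membership.Propositional.Properties using (∈-map⁺; ∈-map⁻; ∈-filter⁺; ∈-filter⁻; ∈-++⁺ˡ; ∈-++⁺ʳ; ∈-lookup; ∈-allFin; ∈-concatMap⁺; ∈-concatMap⁻; ∈-cartesianProduct⁺; ∈-cartesianProduct⁻)
open import Data.List.Membership.Propositional.Properties.WithK using (unique∧set⇒bag)
open import Data.List.Membership.DecPropositional using () renaming (_∈?_ to _∈?ᴸ_)
open import Data.List.Relation.Unary.Any using (here; there)
import Data.List.Relation.Unary.Any as Any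
open import Data.List.Relation.Unary.Any.Properties using (lookup-index)
import Data.List.Relation.Unary.All as All
import Data.List.Relation.Unary.All.Properties as All
open import Data.List.Relation.Unary.AllPairs using ([]; _∷_)
import Data.List.Relation.Unary.AllPairs as AllPairs
import Data.List.Relation.Unary.AllPairs.Properties as AllPairs
open import Data.List.Relation.Unary.Unique.Propositional using (Unique)
import Data.List.Relation.Unary.Unique.Propositional.Properties as Unique
open import Data.List.Relation.Binary.Disjoint.Propositional using (Disjoint)
open import Data.List.Relation.Binary.BagAndSetEquality using (∼bag⇒↭)
open import Data.List.Relation.Binary.Permutation.Propositional.Properties using (↭-length)

module _ {X Y : Set} where

  length-cartesianProduct : (xs : List X) (ys : List Y) →
                            length (cartesianProduct xs ys) ≡ length xs * length ys
  length-cartesianProduct []       ys = refl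
  length-cartesianProduct (x ∷ xs) ys = begin
    length (map (x ,_) ys ++ cartesianProduct xs ys)          ≡⟨ length-++ (map (x ,_) ys) ⟩
    length (map (x ,_) ys) + length (cartesianProduct xs ys)  ≡⟨ cong₂ _+_ (length-map (x ,_) ys)
                                                                             (length-cartesianProduct xs ys) ⟩
    length ys + length xs * length ys                         ∎
    where open ≡-Reasoning

  map⁺-injectiveOn : (f : X → Y) {xs : List X} → Unique xs →
                     (∀ {x y} → x ∈ xs → y ∈ xs → f x ≡ f y → x ≡ y) → Unique (map f xs)
  map⁺-injectiveOn f []           inj = []
  map⁺-injectiveOn f (x∉xs ∷ uxs) inj =
    All.tabulate (λ y∈ fx≡y → let x′ , x′∈ , y≡fx′ = ∈-map⁻ f y∈ in
                                All.lookup x∉xs x′∈ (inj (here refl) (there x′∈) (trans fx≡y y≡fx′)))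
    ∷ map⁺-injectiveOn f uxs (λ x∈ y∈ → inj (there x∈) (there y∈))

  length-≡-by-bijection : {xs : List X} {ys : List Y} → Unique xs → Unique ys → (f : X → Y) →
                          (∀ {x} → x ∈ xs → f x ∈ ys) →
                          (∀ {x y} → x ∈ xs → y ∈ xs → f x ≡ f y → x ≡ y) →
                          (∀ {y} → y ∈ ys → ∃ λ x → x ∈ xs × f x ≡ y) →
                          length xs ≡ length ys
  length-≡-by-bijection {xs} {ys} uxs uys f into inj onto = begin
    length xs          ≡⟨ length-map f xs ⟨
    length (map f xs)  ≡⟨ ↭-length (∼bag⇒↭ (unique∧set⇒bag (map⁺-injectiveOn f uxs inj) uys
                                                             (mk⇔ to from))) ⟩
    length ys          ∎
    where
    to : ∀ {y} → y ∈ map f xs → y ∈ ys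
    to y∈ with _ , x∈ , refl ← ∈-map⁻ f y∈ = into x∈
    from : ∀ {y} → y ∈ ys → y ∈ map f xs
    from y∈ with _ , x∈ , refl ← onto y∈ = ∈-map⁺ f x∈
    open ≡-Reasoning

  length-≤-by-injection : DecidableEquality Y → {xs : List X} {ys : List Y} → Unique xs → Unique ys →
                          (f : X → Y) → (∀ {x} → x ∈ xs → f x ∈ ys) →
                          (∀ {x y} → x ∈ xs → y ∈ xs → f x ≡ f y → x ≡ y) →
                          length xs ≤ length ys
  length-≤-by-injection _≟_ {xs} {ys} uxs uys f into inj =
    ≤-trans (≤-reflexive (length-≡-by-bijection uxs (Unique.filter⁺ image? uys) f into′ inj onto))
            (length-filter image? ys)
    where
    image? : ∀ y → Dec (y ∈ map f xs)
    image? y = _∈?ᴸ_ _≟_ y (map f xs)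
    image : List Y
    image = filter image? ys
    into′ : ∀ {x} → x ∈ xs → f x ∈ image
    into′ x∈ = ∈-filter⁺ image? (into x∈) (∈-map⁺ f x∈)
    onto : ∀ {y} → y ∈ image → ∃ λ x → x ∈ xs × f x ≡ y
    onto y∈ with _ , x∈ , refl ← ∈-map⁻ f (proj₂ (∈-filter⁻ image? {xs = ys} y∈)) = _ , x∈ , refl

lookup-injective : ∀ {X : Set} {xs : List X} → Unique xs → ∀ {i j} → List.lookup xs i ≡ List.lookup xs j → i ≡ j
lookup-injective {xs = _ ∷ _} _            {zero}  {zero}  _  = refl
lookup-injective {xs = _ ∷ _} (x∉xs ∷ _)   {zero}  {suc j} eq = ⊥-elim (All.lookup x∉xs (∈-lookup j) eq)
lookup-injective {xs = _ ∷ _} (x∉xs ∷ _)   {suc i} {zero}  eq = ⊥-elim (All.lookup x∉xs (∈-lookup i) (sym eq))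
lookup-injective {xs = _ ∷ _} (_ ∷ uxs)    {suc i} {suc j} eq = cong suc (lookup-injective uxs eq)

∈-allSubsets : ∀ {k} (p : Subset k) → p ∈ allSubsets k
∈-allSubsets []               = here refl
∈-allSubsets {suc k} (true ∷ p)  = ∈-++⁺ˡ (∈-map⁺ (true ∷_) (∈-allSubsets p))
∈-allSubsets {suc k} (false ∷ p) = ∈-++⁺ʳ (map (true ∷_) (allSubsets k)) (∈-map⁺ (false ∷_) (∈-allSubsets p))

allSubsets-unique : ∀ k → Unique (allSubsets k)
allSubsets-unique zero    = All.[] ∷ []
allSubsets-unique (suc k) = Unique.++⁺ (Unique.map⁺ ∷-injectiveʳ (allSubsets-unique k))
                                       (Unique.map⁺ ∷-injectiveʳ (allSubsets-unique k)) heads-differ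
  where
  heads-differ : Disjoint (map (true ∷_) (allSubsets k)) (map (false ∷_) (allSubsets k))
  heads-differ (p∈ , q∈) with _ , _ , refl ← ∈-map⁻ (true ∷_) p∈ with _ , _ , () ← ∈-map⁻ (false ∷_) q∈

satisfying : {Ω : Set} → (Ω → Bool) → List Ω → List Ω
satisfying E = filter (λ ω → E ω ≟ᵇ true)

count-cong : {Ω : Set} (xs : List Ω) {E E′ : Ω → Bool} → (∀ ω → E ω ≡ E′ ω) → count xs E ≡ count xs E′
count-cong []       eq = refl
count-cong (ω ∷ xs) {E} {E′} eq with E ω | E′ ω | eq ω
... | true  | true  | refl = cong suc (count-cong xs eq)
... | false | false | refl = count-cong xs eq

count-tabulate : {X : Set} {k : ℕ} (g : Fin k → X) (E : X → Bool) →
                 count (tabulate g) E ≡ ∣ Vec.tabulate (E ∘ g) ∣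
count-tabulate {k = zero}  g E = refl
count-tabulate {k = suc k} g E with E (g zero)
... | true  = cong suc (count-tabulate (g ∘ suc) E)
... | false = count-tabulate (g ∘ suc) E

∣p∣≡count : ∀ {k} (p : Subset k) → ∣ p ∣ ≡ count (allFin k) (Vec.lookup p)
∣p∣≡count p = sym (trans (count-tabulate id (Vec.lookup p)) (cong ∣_∣ (tabulate∘lookup p)))

∣p[x]≔true∣≡1+∣p[x]≔false∣ : ∀ {k} (p : Subset k) x → ∣ p [ x ]≔ true ∣ ≡ suc ∣ p [ x ]≔ false ∣
∣p[x]≔true∣≡1+∣p[x]≔false∣ (_ ∷ p)     zero    = refl
∣p[x]≔true∣≡1+∣p[x]≔false∣ (true ∷ p)  (suc x) = cong suc (∣p[x]≔true∣≡1+∣p[x]≔false∣ p x)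
∣p[x]≔true∣≡1+∣p[x]≔false∣ (false ∷ p) (suc x) = ∣p[x]≔true∣≡1+∣p[x]≔false∣ p x

∈-tabulate⁺ : ∀ {k} {f : Fin k → Bool} {x} → f x ≡ true → x ∈ˢ Vec.tabulate f
∈-tabulate⁺ {f = f} {x} h = lookup⇒[]= x (Vec.tabulate f) (trans (lookup∘tabulate f x) h)

∈-tabulate⁻ : ∀ {k} {f : Fin k → Bool} {x} → x ∈ˢ Vec.tabulate f → f x ≡ true
∈-tabulate⁻ {f = f} {x} x∈ = trans (sym (lookup∘tabulate f x)) ([]=⇒lookup x∈)

punchIn′ : ∀ {n} → Fin n → Fin (n ∸ 1) → Fin n
punchIn′ {suc n} = punchIn

punchIn′-injective : ∀ {n} (r : Fin n) {j j′} → punchIn′ r j ≡ punchIn′ r j′ → j ≡ j′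
punchIn′-injective {suc n} r = punchIn-injective r _ _

punchIn′≢ : ∀ {n} (r : Fin n) j → punchIn′ r j ≢ r
punchIn′≢ {suc n} r j = punchInᵢ≢i r j

module _ {k : ℕ} (R : ℕ → Subset k)
         (R-increasing : ∀ j → R j ⊆ R (suc j))
         (R-stationary : ∀ j → R (suc j) ⊆ R j → R (suc (suc j)) ⊆ R (suc j)) where

  private
    R-grows : ∀ i {j} → R j ⊆ R (i + j)
    R-grows zero    x∈ = x∈
    R-grows (suc i) x∈ = R-increasing _ (R-grows i x∈)

    R-stays : ∀ {j} → R (suc j) ⊆ R j → ∀ i → R (i + j) ⊆ R j
    R-stays {j} stop zero    x∈ = x∈
    R-stays {j} stop (suc i) x∈ = R-stays stop i (stays i x∈)
      where
      stays : ∀ i → R (suc (i + j)) ⊆ R (i + j)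
      stays zero    = stop
      stays (suc i) = R-stationary (i + j) (stays i)

    stops-or-grows : ∀ j → (∃ λ j′ → j′ < j × R (suc j′) ⊆ R j′) ⊎ j ≤ ∣ R j ∣
    stops-or-grows zero = inj₂ z≤n
    stops-or-grows (suc j) with stops-or-grows j
    ... | inj₁ (j′ , j′<j , stop) = inj₁ (j′ , m≤n⇒m≤1+n j′<j , stop)
    ... | inj₂ j≤∣Rj∣ with any? (λ x → x ∈? R (suc j) ×-dec ¬? (x ∈? R j))
    ...   | yes (x , x∈ , x∉) =
      inj₂ (≤-trans (s≤s j≤∣Rj∣) (p⊂q⇒∣p∣<∣q∣ (R-increasing j , x , x∈ , x∉)))
    ...   | no  none          = inj₁ (j , ≤-refl , stop)
      where
      stop : R (suc j) ⊆ R j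
      stop {x} x∈ with x ∈? R j
      ... | yes x∈′ = x∈′
      ... | no  x∉  = ⊥-elim (none (x , x∈ , x∉))

  -- Until it becomes stationary the chain gains an element at every step, which can happen at
  -- most k times.
  chain-stabilises : ∀ j → R j ⊆ R k
  chain-stabilises j with stops-or-grows (suc k)
  ... | inj₂ k<∣R∣ = ⊥-elim (n≮n k (≤-trans k<∣R∣ (∣p∣≤n (R (suc k)))))
  ... | inj₁ (j′ , j′<1+k , stop) = λ x∈ →
    subst (λ l → R j′ ⊆ R l) (m∸n+n≡m (≤-pred j′<1+k)) (R-grows (k ∸ j′))
      (R-stays stop j (subst (λ l → R j ⊆ R l) (+-comm j′ j) (R-grows j′) x∈))

module _ (P : ℕ → Bool) (P-step : ∀ k → P k ≡ true → P (suc k) ≡ true) where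

  private
    P-mono : ∀ {j k} → j ≤′ k → P j ≡ true → P k ≡ true
    P-mono ≤′-refl        h = h
    P-mono (≤′-step j≤k) h = P-step _ (P-mono j≤k h)

  least : ∀ k → P k ≡ true → ∃ λ d → P d ≡ true × (∀ {d′} → P d′ ≡ true → d ≤ d′)
  least zero    h = zero , h , λ _ → z≤n
  least (suc k) h with P k in Pk
  ... | true  = least k Pk
  ... | false = suc k , h , λ h′ → ≰⇒> (λ d′≤k → not-¬ (P-mono (≤⇒≤′ d′≤k) h′) Pk)

module _ {X : Set} (p : X → Bool) where

  any≡true⁺ : ∀ {xs x} → x ∈ xs → p x ≡ true → any p xs ≡ true
  any≡true⁺ (here refl) px rewrite px = refl
  any≡true⁺ {y ∷ _} (there x∈) px with p y
  ... | true  = refl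
  ... | false = any≡true⁺ x∈ px

  any≡true⁻ : ∀ xs → any p xs ≡ true → ∃ λ x → p x ≡ true
  any≡true⁻ (x ∷ xs) h with p x in px
  ... | true  = x , px
  ... | false = any≡true⁻ xs h

  all≡true⁺ : ∀ xs → (∀ {x} → x ∈ xs → p x ≡ true) → all p xs ≡ true
  all≡true⁺ []       h = refl
  all≡true⁺ (x ∷ xs) h = cong₂ _∧_ (h (here refl)) (all≡true⁺ xs (h ∘ there))

  all≡true⁻ : ∀ {xs x} → all p xs ≡ true → x ∈ xs → p x ≡ true
  all≡true⁻ {y ∷ xs} h (here refl) = ∧-conicalˡ (p y) _ h
  all≡true⁻ {y ∷ xs} h (there x∈) = all≡true⁻ (∧-conicalʳ (p y) _ h) x∈

∨≡true⁻ : ∀ x {y} → x ∨ y ≡ true → x ≡ true ⊎ y ≡ true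
∨≡true⁻ true  _ = inj₁ refl
∨≡true⁻ false h = inj₂ h

eqF≡true⇒≡ : ∀ {k} {u v : Fin k} → eqF u v ≡ true → u ≡ v
eqF≡true⇒≡ {u = u} {v} with u ≟ v
... | yes u≡v = λ _ → u≡v
... | no  _   = λ ()

eqF≡false⇒≢ : ∀ {k} {u v : Fin k} → eqF u v ≡ false → u ≢ v
eqF≡false⇒≢ {u = u} {v} with u ≟ v
... | yes _   = λ ()
... | no  u≢v = λ _ → u≢v

eqF-refl : ∀ {k} (u : Fin k) → eqF u u ≡ true
eqF-refl u with u ≟ u
... | yes _   = refl
... | no  u≢u = ⊥-elim (u≢u refl)

≢⇒eqF≡false : ∀ {k} {u v : Fin k} → u ≢ v → eqF u v ≡ false
≢⇒eqF≡false {u = u} {v} u≢v with u ≟ v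
... | yes u≡v = ⊥-elim (u≢v u≡v)
... | no  _   = refl

cross-multiply : ∀ {a b c d k l} .{{_ : NonZero l}} → a * k ≡ c * l → b * k ≡ d * l → a * d ≡ b * c
cross-multiply {a} {b} {c} {d} {k} {l} ak≡cl bk≡dl = *-cancelʳ-≡ (a * d) (b * c) l (begin
  a * d * l      ≡⟨ *-assoc a d l ⟩
  a * (d * l)    ≡⟨ cong (a *_) bk≡dl ⟨
  a * (b * k)    ≡⟨ x∙yz≈y∙xz a b k ⟩
  b * (a * k)    ≡⟨ cong (b *_) ak≡cl ⟩
  b * (c * l)    ≡⟨ *-assoc b c l ⟨
  b * c * l      ∎)
  where open ≡-Reasoning

frac-nonNeg : ∀ a b → 0ℚ ℚ.≤ frac a b
frac-nonNeg a zero    = ℚᴾ.≤-refl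
frac-nonNeg a (suc b) = ℚᴾ.nonNegative⁻¹ (+ a ℚ./ suc b) {{ℚᴾ.normalize-nonNeg a (suc b)}}

frac-zero-≤ : ∀ b c d → frac 0 b ℚ.≤ frac c d
frac-zero-≤ zero    c d = frac-nonNeg c d
frac-zero-≤ (suc b) c d = ℚᴾ.≤-trans (ℚᴾ.≤-reflexive (ℚᴾ.0/n≡0 (suc b))) (frac-nonNeg c d)

-- frac a 0 is the junk value 0ℚ, and frac a (suc b) = + a / suc b = fromℚᵘ (mkℚᵘ (+ a) b) by
-- definition.
frac-cross-≤ : ∀ {a b c d} → b ≤ d → a * d ≡ c * b → frac a b ℚ.≤ frac c d
frac-cross-≤ {a} {zero}  {c} {d}     _ _  = frac-nonNeg c d
frac-cross-≤ {a} {suc b} {c} {suc d} _ eq =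
  ℚᴾ.≤-reflexive (ℚᴾ.fromℚᵘ-cong {ℚᵘ.mkℚᵘ (+ a) b} {ℚᵘ.mkℚᵘ (+ c) d}
    (ℚᵘ.*≡* (trans (sym (pos-* a (suc d))) (trans (cong +_ eq) (pos-* c (suc b))))))

disjoint⇒PrCond≤Pr : {Ω : Set} (space : List Ω) (P Q : Ω → Bool) → (∀ ω → P ω ∧ Q ω ≡ false) →
                     PrCond space P Q ℚ.≤ Pr space P
disjoint⇒PrCond≤Pr space P Q disjoint =
  subst (λ c → frac c (count space Q) ℚ.≤ Pr space P)
        (sym (cong length (filter-none (λ ω → P ω ∧ Q ω ≟ᵇ true)
                                       (All.universal (λ ω PQω → not-¬ PQω (disjoint ω)) space))))
        (frac-zero-≤ (count space Q) (count space P) (length space))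

module _ {n : ℕ} where

  -- Edge sets and walks in K_n

  -- The inductive membership of Data.Fin.Subset rather than lookup F e ≡ true, so that the edge
  -- set F can be inferred from a proof of e ∈ᴱ F.
  infix 4 _∈ᴱ_
  _∈ᴱ_ : Edge n → EdgeSet n → Set
  _∈ᴱ_ = _∈ˢ_

  infixl 6 _-ᴱ_ _+ᴱ_
  _-ᴱ_ _+ᴱ_ : EdgeSet n → Edge n → EdgeSet n
  F -ᴱ e = F [ e ]≔ false
  F +ᴱ e = F [ e ]≔ true

  ∈-+ᴱ-new : ∀ F e → e ∈ᴱ F +ᴱ e
  ∈-+ᴱ-new = []≔-updates

  ∈-+ᴱ : ∀ {F e} f → e ∈ᴱ F → e ∈ᴱ F +ᴱ f
  ∈-+ᴱ {F} {e} f e∈F with e ≟ f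
  ... | yes refl = ∈-+ᴱ-new F f
  ... | no  e≢f  = []≔-minimal F e f e≢f e∈F

  ∈-+ᴱ⁻ : ∀ F f {e} → e ∈ᴱ F +ᴱ f → e ∈ᴱ F ⊎ e ≡ f
  ∈-+ᴱ⁻ F f {e} e∈ with e ≟ f
  ... | yes e≡f = inj₂ e≡f
  ... | no  e≢f = inj₁ (lookup⇒[]= e F (trans (sym (lookup∘update′ e≢f F true)) ([]=⇒lookup e∈)))

  ∈--ᴱ : ∀ {F e f} → e ∈ᴱ F → e ≢ f → e ∈ᴱ F -ᴱ f
  ∈--ᴱ {F} {e} {f} e∈F e≢f = []≔-minimal F e f e≢f e∈F

  ∈--ᴱ⁻ : ∀ F f {e} → e ∈ᴱ F -ᴱ f → e ∈ᴱ F × e ≢ f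
  ∈--ᴱ⁻ F f {e} e∈ with e ≟ f
  ... | yes refl with () ← trans (sym (lookup∘update f F false)) ([]=⇒lookup e∈)
  ... | no  e≢f  = lookup⇒[]= e F (trans (sym (lookup∘update′ e≢f F false)) ([]=⇒lookup e∈)) , e≢f

  []≔-unchanged : ∀ (F : EdgeSet n) e {b} → Vec.lookup F e ≡ b → F [ e ]≔ b ≡ F
  []≔-unchanged F e eq = trans (cong (F [ e ]≔_) (sym eq)) ([]≔-lookup F e)

  ∉ᴱ⇒lookup≡false : ∀ {F e} → ¬ e ∈ᴱ F → Vec.lookup F e ≡ false
  ∉ᴱ⇒lookup≡false {F} {e} e∉F = ¬-not (e∉F ∘ lookup⇒[]= e F)

  -ᴱ-+ᴱ : ∀ {F e} → e ∈ᴱ F → F -ᴱ e +ᴱ e ≡ F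
  -ᴱ-+ᴱ {F} {e} e∈F = trans ([]≔-idempotent F e) ([]≔-unchanged F e ([]=⇒lookup e∈F))

  +ᴱ--ᴱ : ∀ {F e} → ¬ e ∈ᴱ F → F +ᴱ e -ᴱ e ≡ F
  +ᴱ--ᴱ {F} {e} e∉F = trans ([]≔-idempotent F e) ([]≔-unchanged F e (∉ᴱ⇒lookup≡false e∉F))

  ∣-ᴱ∣ : ∀ {F e} → e ∈ᴱ F → suc ∣ F -ᴱ e ∣ ≡ ∣ F ∣
  ∣-ᴱ∣ {F} {e} e∈F =
    trans (sym (∣p[x]≔true∣≡1+∣p[x]≔false∣ F e)) (cong ∣_∣ ([]≔-unchanged F e ([]=⇒lookup e∈F)))

  ∣+ᴱ∣ : ∀ {F e} → ¬ e ∈ᴱ F → ∣ F +ᴱ e ∣ ≡ suc ∣ F ∣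
  ∣+ᴱ∣ {F} {e} e∉F =
    trans (∣p[x]≔true∣≡1+∣p[x]≔false∣ F e) (cong (suc ∘ ∣_∣) ([]≔-unchanged F e (∉ᴱ⇒lookup≡false e∉F)))

  private
    row : Fin n → List (Fin n × Fin n)
    row u = map (λ v → (u , v)) (filter (λ v → toℕ u <? toℕ v) (allFin n))

    ∈-row⁻ : ∀ {u p} → p ∈ row u → proj₁ p ≡ u × toℕ u < toℕ (proj₂ p)
    ∈-row⁻ {u} p∈ with v , v∈ , refl ← ∈-map⁻ (λ v → (u , v)) p∈ =
      refl , proj₂ (∈-filter⁻ (λ v → toℕ u <? toℕ v) {xs = allFin n} v∈)

  ∈-edgeList⁺ : ∀ {u v} → toℕ u < toℕ v → (u , v) ∈ edgeList n
  ∈-edgeList⁺ {u} {v} u<v = ∈-concatMap⁺ row {xs = allFin n} (Any.map (λ { refl → v∈row }) (∈-allFin u))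
    where
    v∈row : (u , v) ∈ row u
    v∈row = ∈-map⁺ (λ v → (u , v)) (∈-filter⁺ (λ v → toℕ u <? toℕ v) (∈-allFin v) u<v)

  ∈-edgeList⁻ : ∀ {p} → p ∈ edgeList n → toℕ (proj₁ p) < toℕ (proj₂ p)
  ∈-edgeList⁻ p∈ with u , p∈row ← Any.satisfied (∈-concatMap⁻ row {xs = allFin n} p∈)
                  with refl , u<v ← ∈-row⁻ p∈row = u<v

  edgeList-unique : Unique (edgeList n)
  edgeList-unique = Unique.concat⁺ (All.map⁺ (All.universal row-unique (allFin n)))
                                   (AllPairs.map⁺ (AllPairs.map rows-disjoint (Unique.allFin⁺ n)))
    where
    row-unique : ∀ u → Unique (row u)
    row-unique u = Unique.map⁺ (λ eq → proj₂ (,-injective eq))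
                               (Unique.filter⁺ (λ v → toℕ u <? toℕ v) (Unique.allFin⁺ n))
    rows-disjoint : ∀ {u u′} → u ≢ u′ → Disjoint (row u) (row u′)
    rows-disjoint u≢u′ (p∈ , p∈′) = u≢u′ (trans (sym (proj₁ (∈-row⁻ p∈))) (proj₁ (∈-row⁻ p∈′)))

  ends-injective : ∀ {e f} → ends {n} e ≡ ends {n} f → e ≡ f
  ends-injective = lookup-injective edgeList-unique

  edges : EdgeSet n → List (Edge n)
  edges F = satisfying (Vec.lookup F) (allFin (m n))

  ∣F∣≡length-edges : ∀ F → ∣ F ∣ ≡ length (edges F)
  ∣F∣≡length-edges = ∣p∣≡count

  edges-unique : ∀ F → Unique (edges F)
  edges-unique F = Unique.filter⁺ (λ e → Vec.lookup F e ≟ᵇ true) (Unique.allFin⁺ (m n))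

  ∈-edges⁺ : ∀ F {e} → e ∈ᴱ F → e ∈ edges F
  ∈-edges⁺ F {e} = ∈-filter⁺ (λ e → Vec.lookup F e ≟ᵇ true) (∈-allFin e) ∘ []=⇒lookup

  Joins : Edge n → Fin n → Fin n → Set
  Joins e u v = ends {n} e ≡ (u , v) ⊎ ends {n} e ≡ (v , u)

  Touches : Edge n → Fin n → Set
  Touches e w = proj₁ (ends {n} e) ≡ w ⊎ proj₂ (ends {n} e) ≡ w

  Meets : Edge n → Edge n → Set
  Meets e f = ∃ λ w → Touches e w × Touches f w

  Joins-sym : ∀ {e u v} → Joins e u v → Joins e v u
  Joins-sym = Sum.swap

  Joins⇒Touchesˡ : ∀ {e u v} → Joins e u v → Touches e u
  Joins⇒Touchesˡ (inj₁ eq) = inj₁ (cong proj₁ eq)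
  Joins⇒Touchesˡ (inj₂ eq) = inj₂ (cong proj₂ eq)

  Joins⇒Touchesʳ : ∀ {e u v} → Joins e u v → Touches e v
  Joins⇒Touchesʳ = Joins⇒Touchesˡ ∘ Joins-sym

  Touches-Joins : ∀ {e u v w} → Joins e u v → Touches e w → w ≡ u ⊎ w ≡ v
  Touches-Joins (inj₁ eq) (inj₁ t) = inj₁ (trans (sym t) (cong proj₁ eq))
  Touches-Joins (inj₁ eq) (inj₂ t) = inj₂ (trans (sym t) (cong proj₂ eq))
  Touches-Joins (inj₂ eq) (inj₁ t) = inj₂ (trans (sym t) (cong proj₁ eq))
  Touches-Joins (inj₂ eq) (inj₂ t) = inj₁ (trans (sym t) (cong proj₂ eq))

  Joins-higher-unique : ∀ (rank : Fin n → ℕ) {e v v′ w w′} → Joins e w v → Joins e w′ v′ →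
                        rank w < rank v → rank w′ < rank v′ → v ≡ v′
  Joins-higher-unique rank j j′ w<v w′<v′
    with Touches-Joins j (Joins⇒Touchesʳ j′) | Touches-Joins j′ (Joins⇒Touchesʳ j)
  ... | inj₂ v′≡v | _         = sym v′≡v
  ... | inj₁ _    | inj₂ v≡v′ = v≡v′
  ... | inj₁ refl | inj₁ refl = ⊥-elim (<-asym w<v w′<v′)

  private
    ends-ordered : ∀ {e u v} → ends {n} e ≡ (u , v) → toℕ u < toℕ v
    ends-ordered {e} eq = subst (λ p → toℕ (proj₁ p) < toℕ (proj₂ p)) eq (∈-edgeList⁻ (∈-lookup e))

  Joins⇒≢ : ∀ {e u v} → Joins e u v → u ≢ v
  Joins⇒≢ (inj₁ eq) refl = <-irrefl refl (ends-ordered eq)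
  Joins⇒≢ (inj₂ eq) refl = <-irrefl refl (ends-ordered eq)

  Joins-injective : ∀ {e f u v} → Joins e u v → Joins f u v → e ≡ f
  Joins-injective (inj₁ eq) (inj₁ eq′) = ends-injective (trans eq (sym eq′))
  Joins-injective (inj₂ eq) (inj₂ eq′) = ends-injective (trans eq (sym eq′))
  Joins-injective (inj₁ eq) (inj₂ eq′) = ⊥-elim (<-asym (ends-ordered eq) (ends-ordered eq′))
  Joins-injective (inj₂ eq) (inj₁ eq′) = ⊥-elim (<-asym (ends-ordered eq) (ends-ordered eq′))

  -- The first argument is a junk value, returned when u ≡ v.
  edgeBetween : Edge n → Fin n → Fin n → Edge n
  edgeBetween d u v with <-cmp u v
  ... | tri< u<v _ _ = Any.index (∈-edgeList⁺ u<v)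
  ... | tri≈ _ _ _   = d
  ... | tri> _ _ v<u = Any.index (∈-edgeList⁺ v<u)

  edgeBetween-joins : ∀ d {u v} → u ≢ v → Joins (edgeBetween d u v) u v
  edgeBetween-joins d {u} {v} u≢v with <-cmp u v
  ... | tri< u<v _ _ = inj₁ (sym (lookup-index (∈-edgeList⁺ u<v)))
  ... | tri≈ _ u≡v _ = ⊥-elim (u≢v u≡v)
  ... | tri> _ _ v<u = inj₂ (sym (lookup-index (∈-edgeList⁺ v<u)))

  edgeBetween-unique : ∀ d {e u v} → Joins e u v → edgeBetween d u v ≡ e
  edgeBetween-unique d j = Joins-injective (edgeBetween-joins d (Joins⇒≢ j)) j

  Adjacent : (Edge n → Set) → Rel (Fin n) 0ℓ
  Adjacent P u v = ∃ λ e → P e × Joins e u v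

  Walk : (Edge n → Set) → Rel (Fin n) 0ℓ
  Walk P = Star (Adjacent P)

  Path : EdgeSet n → Rel (Fin n) 0ℓ
  Path F = Walk (_∈ᴱ F)

  Connected : EdgeSet n → Set
  Connected F = ∀ u v → Path F u v

  walk-reverse : ∀ {P u v} → Walk P u v → Walk P v u
  walk-reverse = Star.reverse (λ (e , pe , j) → e , pe , Joins-sym j)

  walk-mono : ∀ {P Q : Edge n → Set} → (∀ {e} → P e → Q e) → Walk P ⇒ Walk Q
  walk-mono P⊆Q = Star.map (λ (e , pe , j) → e , P⊆Q pe , j)

  edge-path : ∀ {F e u v} → e ∈ᴱ F → Joins e u v → Path F u v
  edge-path e∈F j = (_ , e∈F , j) ◅ ε

  private
    joins? : Edge n → Fin n → Fin n → Bool
    joins? e u v = (eqF (proj₁ (ends {n} e)) u ∧ eqF (proj₂ (ends {n} e)) v) ∨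
                   (eqF (proj₁ (ends {n} e)) v ∧ eqF (proj₂ (ends {n} e)) u)

    joins?⇒Joins : ∀ {e u v} → joins? e u v ≡ true → Joins e u v
    joins?⇒Joins {e} {u} {v} h with ∨≡true⁻ (eqF (proj₁ (ends {n} e)) u ∧ eqF (proj₂ (ends {n} e)) v) h
    ... | inj₁ h′ = inj₁ (cong₂ _,_ (eqF≡true⇒≡ (∧-conicalˡ _ _ h′)) (eqF≡true⇒≡ (∧-conicalʳ _ _ h′)))
    ... | inj₂ h′ = inj₂ (cong₂ _,_ (eqF≡true⇒≡ (∧-conicalˡ _ _ h′)) (eqF≡true⇒≡ (∧-conicalʳ _ _ h′)))

    Joins⇒joins? : ∀ {e u v} → Joins e u v → joins? e u v ≡ true
    Joins⇒joins? {e} {u} {v} (inj₁ eq) rewrite eq =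
      cong (_∨ (eqF u v ∧ eqF v u)) (cong₂ _∧_ (eqF-refl u) (eqF-refl v))
    Joins⇒joins? {e} {u} {v} (inj₂ eq) rewrite eq =
      trans (cong (eqF v u ∧ eqF u v ∨_) (cong₂ _∧_ (eqF-refl v) (eqF-refl u))) (∨-zeroʳ _)

  adjacent⇒Adjacent : ∀ {F u v} → adjacent {n} F u v ≡ true → Adjacent (_∈ᴱ F) u v
  adjacent⇒Adjacent {F} {u} {v} h with e , h′ ← any≡true⁻ (λ e → Vec.lookup F e ∧ joins? e u v) (allFin (m n)) h =
    e , lookup⇒[]= e F (∧-conicalˡ _ _ h′) , joins?⇒Joins (∧-conicalʳ _ _ h′)

  Adjacent⇒adjacent : ∀ {F u v} → Adjacent (_∈ᴱ F) u v → adjacent {n} F u v ≡ true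
  Adjacent⇒adjacent {F} {u} {v} (e , e∈F , j) =
    any≡true⁺ (λ e → Vec.lookup F e ∧ joins? e u v) (∈-allFin e) (cong₂ _∧_ ([]=⇒lookup e∈F) (Joins⇒joins? j))

  module _ (F : EdgeSet n) where

    reach⇒Path : ∀ k {u v} → reach {n} F k u v ≡ true → Path F u v
    reach⇒Path zero    h = subst (Path F _) (eqF≡true⇒≡ h) ε
    reach⇒Path (suc k) {u} {v} h with ∨≡true⁻ (reach {n} F k u v) h
    ... | inj₁ h′ = reach⇒Path k h′
    ... | inj₂ h′ with w , h″ ← any≡true⁻ (λ w → reach {n} F k u w ∧ adjacent {n} F w v) (allFin n) h′ =
      reach⇒Path k (∧-conicalˡ _ _ h″) ◅◅ adjacent⇒Adjacent {F} (∧-conicalʳ _ _ h″) ◅ ε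

    reach-step : ∀ k u {v} → reach {n} F k u v ≡ true → reach {n} F (suc k) u v ≡ true
    reach-step k u {v} h = cong (_∨ any (λ w → reach {n} F k u w ∧ adjacent {n} F w v) (allFin n)) h

    reach-snoc : ∀ k u {w v} → reach {n} F k u w ≡ true → Adjacent (_∈ᴱ F) w v → reach {n} F (suc k) u v ≡ true
    reach-snoc k u {w} {v} h adj =
      trans (cong (reach {n} F k u v ∨_) (any≡true⁺ (λ w → reach {n} F k u w ∧ adjacent {n} F w v) (∈-allFin w)
                                                      (cong₂ _∧_ h (Adjacent⇒adjacent {F} adj))))
            (∨-zeroʳ _)

    reach-bound : ∀ k u {v} → reach {n} F k u v ≡ true → reach {n} F n u v ≡ true
    reach-bound k u h =
      ∈-tabulate⁻ (chain-stabilises R R-increasing R-stationary k (∈-tabulate⁺ h))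
      where
      R : ℕ → Subset n
      R k = Vec.tabulate (reach {n} F k u)
      R-increasing : ∀ k → R k ⊆ R (suc k)
      R-increasing k = ∈-tabulate⁺ ∘ reach-step k u ∘ ∈-tabulate⁻
      R-stationary : ∀ k → R (suc k) ⊆ R k → R (suc (suc k)) ⊆ R (suc k)
      R-stationary k stop {v} v∈ with ∨≡true⁻ (reach {n} F (suc k) u v) (∈-tabulate⁻ v∈)
      ... | inj₁ h′ = ∈-tabulate⁺ h′
      ... | inj₂ h′ with w , h″ ← any≡true⁻ (λ w → reach {n} F (suc k) u w ∧ adjacent {n} F w v) (allFin n) h′ =
        ∈-tabulate⁺ (reach-snoc k u (∈-tabulate⁻ (stop (∈-tabulate⁺ (∧-conicalˡ _ _ h″))))
                                    (adjacent⇒Adjacent {F} (∧-conicalʳ _ _ h″)))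

    Path⇒reach : ∀ {u v} → Path F u v → reach {n} F n u v ≡ true
    Path⇒reach {u} p = let k , h = extend {0} (eqF-refl u) p in reach-bound k u h
      where
      extend : ∀ {k w v} → reach {n} F k u w ≡ true → Path F w v → ∃ λ k′ → reach {n} F k′ u v ≡ true
      extend {k} h ε         = k , h
      extend {k} h (adj ◅ p) = extend {suc k} (reach-snoc k u h adj) p

    connected⇒Connected : connected {n} F ≡ true → Connected F
    connected⇒Connected h u v =
      reach⇒Path n (all≡true⁻ (λ v → reach {n} F n u v) (all≡true⁻ _ h (∈-allFin u)) (∈-allFin v))

    Connected⇒connected : Connected F → connected {n} F ≡ true
    Connected⇒connected conn =
      all≡true⁺ _ (allFin n) (λ {u} _ → all≡true⁺ _ (allFin n) (λ {v} _ → Path⇒reach (conn u v)))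

  -- Spanning trees

  record IsTree (F : EdgeSet n) : Set where
    constructor isTree
    field
      isConnected : Connected F
      edgeCount   : ∣ F ∣ ≡ n ∸ 1

  isSpanningTree⇒IsTree : ∀ {F} → isSpanningTree {n} F ≡ true → IsTree F
  isSpanningTree⇒IsTree {F} h =
    isTree (connected⇒Connected F (∧-conicalˡ _ _ h))
           (≡ᵇ⇒≡ ∣ F ∣ (n ∸ 1) (Equivalence.from T-≡ (∧-conicalʳ _ _ h)))

  IsTree⇒isSpanningTree : ∀ {F} → IsTree F → isSpanningTree {n} F ≡ true
  IsTree⇒isSpanningTree {F} (isTree conn size) =
    cong₂ _∧_ (Connected⇒connected F conn) (Equivalence.to T-≡ (≡⇒≡ᵇ ∣ F ∣ (n ∸ 1) size))

  ∈-spanningTrees⁺ : ∀ {F} → IsTree F → F ∈ spanningTrees n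
  ∈-spanningTrees⁺ {F} tree =
    ∈-filter⁺ (λ F → isSpanningTree {n} F ≟ᵇ true) (∈-allSubsets F) (IsTree⇒isSpanningTree tree)

  ∈-spanningTrees⁻ : ∀ {F} → F ∈ spanningTrees n → IsTree F
  ∈-spanningTrees⁻ F∈ =
    isSpanningTree⇒IsTree (proj₂ (∈-filter⁻ (λ F → isSpanningTree {n} F ≟ᵇ true) {xs = allSubsets (m n)} F∈))

  spanningTrees-unique : Unique (spanningTrees n)
  spanningTrees-unique = Unique.filter⁺ (λ F → isSpanningTree {n} F ≟ᵇ true) (allSubsets-unique (m n))

  module _ {F : EdgeSet n} (conn : Connected F) (r : Fin n) where

    -- Opaque: only this specification of dist is used, and unfolding it is expensive.
    opaque
      private
        distance : ∀ v → ∃ λ d → reach {n} F d r v ≡ true × (∀ {k} → reach {n} F k r v ≡ true → d ≤ k)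
        distance v = least (λ k → reach {n} F k r v) (λ k → reach-step F k r) n (Path⇒reach F (conn r v))

      dist : Fin n → ℕ
      dist v = proj₁ (distance v)

      reach-dist : ∀ v → reach {n} F (dist v) r v ≡ true
      reach-dist v = proj₁ (proj₂ (distance v))

      dist-least : ∀ v {k} → reach {n} F k r v ≡ true → dist v ≤ k
      dist-least v = proj₂ (proj₂ (distance v))

    parent : ∀ v → v ≢ r → ∃ λ e → e ∈ᴱ F × ∃ λ w → Joins e w v × dist w < dist v
    parent v v≢r with dist v | reach-dist v | (λ {k} → dist-least v {k})
    ... | zero  | h | _       = ⊥-elim (v≢r (sym (eqF≡true⇒≡ h)))
    ... | suc d | h | minimal with ∨≡true⁻ (reach {n} F d r v) h
    ...   | inj₁ h′ = ⊥-elim (1+n≰n (minimal h′))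
    ...   | inj₂ h′ with w , h″ ← any≡true⁻ (λ w → reach {n} F d r w ∧ adjacent {n} F w v) (allFin n) h′ =
      let e , e∈F , j = adjacent⇒Adjacent {F} (∧-conicalʳ _ _ h″) in
      e , e∈F , w , j , s≤s (dist-least w (∧-conicalˡ _ _ h″))

  -- Each vertex other than r has an edge to a vertex closer to r, and these edges are distinct.
  Connected⇒n∸1≤∣F∣ : ∀ {F} → Fin n → Connected F → n ∸ 1 ≤ ∣ F ∣
  Connected⇒n∸1≤∣F∣ {F} r conn = begin
    n ∸ 1                    ≡⟨ length-tabulate id ⟨
    length (allFin (n ∸ 1))  ≤⟨ length-≤-by-injection _≟_ (Unique.allFin⁺ (n ∸ 1)) (edges-unique F) parentEdge
                                  (λ {j} _ → ∈-edges⁺ F (proj₁ (proj₂ (parent′ j))))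
                                  (λ {j} {j′} _ _ → injective j j′) ⟩
    length (edges F)         ≡⟨ ∣F∣≡length-edges F ⟨
    ∣ F ∣                    ∎
    where
    open ≤-Reasoning
    parent′ : ∀ j → ∃ λ e → e ∈ᴱ F × ∃ λ w → Joins e w (punchIn′ r j) ×
                                            dist conn r w < dist conn r (punchIn′ r j)
    parent′ j = parent conn r (punchIn′ r j) (punchIn′≢ r j)
    parentEdge : Fin (n ∸ 1) → Edge n
    parentEdge j = proj₁ (parent′ j)
    injective : ∀ j j′ → parentEdge j ≡ parentEdge j′ → j ≡ j′
    injective j j′ eq =
      let _ , _ , _  , jn  , w<v   = parent′ j
          _ , _ , w′ , jn′ , w′<v′ = parent′ j′
      in punchIn′-injective r
           (Joins-higher-unique (dist conn r) jn (subst (λ e → Joins e w′ (punchIn′ r j′)) (sym eq) jn′) w<v w′<v′)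

  -- Exchanging an edge of a spanning tree

  path-until : ∀ {F u v} (f : Edge n) → Path F u v →
               Path (F -ᴱ f) u v ⊎ ∃ λ w → Touches f w × Path (F -ᴱ f) u w
  path-until f ε = inj₁ ε
  path-until {F} {u} f (_◅_ {j = w} (e , e∈F , j) p) with e ≟ f
  ... | yes refl = inj₂ (u , Joins⇒Touchesˡ j , ε)
  ... | no  e≢f  = Sum.map (step ◅_) (Product.map₂ (Product.map₂ (step ◅_))) (path-until f p)
    where
    step : Adjacent (_∈ᴱ F -ᴱ f) u w
    step = e , ∈--ᴱ e∈F e≢f , j

  Connected⇒reaches-ends : ∀ {F f p q} → Connected F → Joins f p q →
                           ∀ u → Path (F -ᴱ f) u p ⊎ Path (F -ᴱ f) u q
  Connected⇒reaches-ends {f = f} conn j u with path-until f (conn u _)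
  ... | inj₁ path = inj₁ path
  ... | inj₂ (w , f∋w , path) with Touches-Joins j f∋w
  ...   | inj₁ refl = inj₁ path
  ...   | inj₂ refl = inj₂ path

  reaches-ends⇒Connected : ∀ {F p q} → (∀ u → Path F u p ⊎ Path F u q) → Path F p q → Connected F
  reaches-ends⇒Connected reaches p→q u v with reaches u | reaches v
  ... | inj₁ u→p | inj₁ v→p = u→p ◅◅ walk-reverse v→p
  ... | inj₁ u→p | inj₂ v→q = u→p ◅◅ p→q ◅◅ walk-reverse v→q
  ... | inj₂ u→q | inj₁ v→p = u→q ◅◅ walk-reverse p→q ◅◅ walk-reverse v→p
  ... | inj₂ u→q | inj₂ v→q = u→q ◅◅ walk-reverse v→q

  tree-edge-separates : ∀ {t f p q} → IsTree t → f ∈ᴱ t → Joins f p q → ¬ Path (t -ᴱ f) p q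
  tree-edge-separates {t} {p = p} (isTree conn size) f∈t j p→q =
    n≮n _ (≤-trans (≤-reflexive (trans (∣-ᴱ∣ {t} f∈t) size))
                   (Connected⇒n∸1≤∣F∣ p (reaches-ends⇒Connected (Connected⇒reaches-ends conn j) p→q)))

  reconnecting-edge-∉ : ∀ {t f g p q x} → IsTree t → f ∈ᴱ t → Joins f p q → Joins g p x → Path (t -ᴱ f) q x →
                        ¬ g ∈ᴱ t -ᴱ f
  reconnecting-edge-∉ tree f∈t jf jg q→x g∈ =
    tree-edge-separates tree f∈t jf (edge-path g∈ jg ◅◅ walk-reverse q→x)

  exchange : ∀ {t f g p q x} → IsTree t → f ∈ᴱ t → Joins f p q → Joins g p x → Path (t -ᴱ f) q x →
             IsTree (t -ᴱ f +ᴱ g)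
  exchange {t} {f} {g} tree@(isTree conn size) f∈t jf jg q→x = isTree conn′ size′
    where
    grow : Path (t -ᴱ f) ⇒ Path (t -ᴱ f +ᴱ g)
    grow = walk-mono (∈-+ᴱ g)
    conn′ : Connected (t -ᴱ f +ᴱ g)
    conn′ = reaches-ends⇒Connected (Sum.map grow grow ∘ Connected⇒reaches-ends conn jf)
                                   (edge-path (∈-+ᴱ-new (t -ᴱ f) g) jg ◅◅ grow (walk-reverse q→x))
    size′ : ∣ t -ᴱ f +ᴱ g ∣ ≡ n ∸ 1
    size′ = trans (∣+ᴱ∣ (reconnecting-edge-∉ tree f∈t jf jg q→x)) (trans (∣-ᴱ∣ {t} f∈t) size)

  module _ {F : EdgeSet n} {p : Fin n} where

    private
      Avoiding : Rel (Fin n) 0ℓ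
      Avoiding = Walk (λ e → e ∈ᴱ F × ¬ Touches e p)

      avoiding-from-p : ∀ {q} → Avoiding p q → p ≡ q
      avoiding-from-p ε = refl
      avoiding-from-p ((_ , (_ , e∌p) , j) ◅ _) = ⊥-elim (e∌p (Joins⇒Touchesˡ j))

      final-exit : ∀ {u q} → p ≢ q → Path F u q →
                   Avoiding u q ⊎ ∃₂ λ e y → e ∈ᴱ F × Joins e p y × Avoiding y q
      final-exit p≢q ε = inj₁ ε
      final-exit {u} p≢q ((e , e∈F , j) ◅ rest) with final-exit p≢q rest
      ... | inj₂ exit = inj₂ exit
      ... | inj₁ avoid with u ≟ p
      ...   | yes refl = inj₂ (e , _ , e∈F , j , avoid)
      ...   | no  u≢p  = inj₁ ((e , (e∈F , e∌p) , j) ◅ avoid)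
        where
        e∌p : ¬ Touches e p
        e∌p e∋p with Touches-Joins j e∋p
        ... | inj₁ p≡u = u≢p (sym p≡u)
        ... | inj₂ refl = p≢q (avoiding-from-p avoid)

    last-exit : ∀ {q} → p ≢ q → Path F p q → ∃₂ λ e y → e ∈ᴱ F × Joins e p y × Path (F -ᴱ e) y q
    last-exit p≢q p→q with final-exit p≢q p→q
    ... | inj₁ avoid = ⊥-elim (p≢q (avoiding-from-p avoid))
    ... | inj₂ (e , y , e∈F , j , avoid) = e , y , e∈F , j , walk-mono away-from-e avoid
      where
      away-from-e : ∀ {g} → g ∈ᴱ F × ¬ Touches g p → g ∈ᴱ F -ᴱ e
      away-from-e (g∈F , g∌p) = ∈--ᴱ {f = e} g∈F (λ { refl → g∌p (Joins⇒Touchesˡ j) })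

  -- Spanning trees through a fixed edge

  module _ (i : Edge n) where

    AwayFrom : (EdgeSet n → Bool) → Set
    AwayFrom E = ∀ t t′ → (∀ e → ¬ Meets i e → Vec.lookup t e ≡ Vec.lookup t′ e) → E t ≡ E t′

    swap : Fin n → EdgeSet n → Fin n → EdgeSet n
    swap p t x = t -ᴱ i +ᴱ edgeBetween i p x

    module _ {p q : Fin n} (i-pq : Joins i p q) where

      record Swappable (t : EdgeSet n) (x : Fin n) : Set where
        constructor swappable
        field
          tree : IsTree t
          i∈t  : i ∈ᴱ t
          q→x  : Path (t -ᴱ i) q x

      swappable⇒≢ : ∀ {t x} → Swappable t x → p ≢ x
      swappable⇒≢ (swappable tree i∈t q→x) refl = tree-edge-separates tree i∈t i-pq (walk-reverse q→x)

      swap-joins : ∀ {t x} → Swappable t x → Joins (edgeBetween i p x) p x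
      swap-joins = edgeBetween-joins i ∘ swappable⇒≢

      swap-IsTree : ∀ {t x} → Swappable t x → IsTree (swap p t x)
      swap-IsTree sw@(swappable tree i∈t q→x) = exchange tree i∈t i-pq (swap-joins sw) q→x

      swap-preserves : ∀ {E t x} → AwayFrom E → Swappable t x → E (swap p t x) ≡ E t
      swap-preserves {t = t} {x} E-away sw = E-away _ _ unchanged
        where
        i∤i : Meets i i
        i∤i = p , Joins⇒Touchesˡ i-pq , Joins⇒Touchesˡ i-pq
        i∤new : Meets i (edgeBetween i p x)
        i∤new = p , Joins⇒Touchesˡ i-pq , Joins⇒Touchesˡ (swap-joins sw)
        unchanged : ∀ e → ¬ Meets i e → Vec.lookup (swap p t x) e ≡ Vec.lookup t e
        unchanged e e∤i = trans (lookup∘update′ {i = e} (λ { refl → e∤i i∤new }) (t -ᴱ i) true)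
                                (lookup∘update′ {i = e} (λ { refl → e∤i i∤i }) t false)

      private
        -- The swapped trees agree, so {p, x₂} ∈ t₁ - i and {p, x₁} ∈ t₂ - i; walking back from x₁
        -- to q in t₁ - i until {p, x₂} is used gives a path from q to p in t₁ - i or in t₂ - i.
        distinct-ends-impossible : ∀ {t₁ x₁ t₂ x₂} → Swappable t₁ x₁ → Swappable t₂ x₂ → x₁ ≢ x₂ →
                                   swap p t₁ x₁ ≢ swap p t₂ x₂
        distinct-ends-impossible {t₁} {x₁} {t₂} {x₂}
                                 sw₁@(swappable tree₁ i∈t₁ q→x₁) sw₂@(swappable tree₂ i∈t₂ q→x₂) x₁≢x₂ eq =
          from-x₁ (path-until e₂ (walk-reverse q→x₁))
          where
          e₁ e₂ : Edge n
          e₁ = edgeBetween i p x₁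
          e₂ = edgeBetween i p x₂
          e₁≢e₂ : e₁ ≢ e₂
          e₁≢e₂ e₁≡e₂
            with Touches-Joins (swap-joins sw₁)
                               (subst (λ e → Touches e x₂) (sym e₁≡e₂) (Joins⇒Touchesʳ (swap-joins sw₂)))
          ... | inj₁ x₂≡p  = swappable⇒≢ sw₂ (sym x₂≡p)
          ... | inj₂ x₂≡x₁ = x₁≢x₂ (sym x₂≡x₁)
          e₂∈t₁-i : e₂ ∈ᴱ t₁ -ᴱ i
          e₂∈t₁-i = Sum.[ id , (λ e₂≡e₁ → ⊥-elim (e₁≢e₂ (sym e₂≡e₁))) ]′
                      (∈-+ᴱ⁻ (t₁ -ᴱ i) e₁ (subst (e₂ ∈ᴱ_) (sym eq) (∈-+ᴱ-new (t₂ -ᴱ i) e₂)))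
          e₁∈t₂-i : e₁ ∈ᴱ t₂ -ᴱ i
          e₁∈t₂-i = Sum.[ id , (λ e₁≡e₂ → ⊥-elim (e₁≢e₂ e₁≡e₂)) ]′
                      (∈-+ᴱ⁻ (t₂ -ᴱ i) e₂ (subst (e₁ ∈ᴱ_) eq (∈-+ᴱ-new (t₁ -ᴱ i) e₁)))
          t₁-i-e₂⊆t₂-i : ∀ {g} → g ∈ᴱ t₁ -ᴱ i -ᴱ e₂ → g ∈ᴱ t₂ -ᴱ i
          t₁-i-e₂⊆t₂-i {g} g∈ with g∈t₁-i , g≢e₂ ← ∈--ᴱ⁻ (t₁ -ᴱ i) e₂ g∈ =
            Sum.[ id , (λ g≡e₂ → ⊥-elim (g≢e₂ g≡e₂)) ]′
              (∈-+ᴱ⁻ (t₂ -ᴱ i) e₂ (subst (g ∈ᴱ_) eq (∈-+ᴱ e₁ g∈t₁-i)))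
          q↛p₁ : ¬ Path (t₁ -ᴱ i) q p
          q↛p₁ = tree-edge-separates tree₁ i∈t₁ i-pq ∘ walk-reverse
          from-x₁ : Path (t₁ -ᴱ i -ᴱ e₂) x₁ q ⊎ ∃ (λ w → Touches e₂ w × Path (t₁ -ᴱ i -ᴱ e₂) x₁ w) → ⊥
          from-x₁ (inj₁ x₁→q) =
            tree-edge-separates tree₂ i∈t₂ i-pq
              (edge-path e₁∈t₂-i (swap-joins sw₁) ◅◅ walk-mono t₁-i-e₂⊆t₂-i x₁→q)
          from-x₁ (inj₂ (w , e₂∋w , x₁→w)) with Touches-Joins (swap-joins sw₂) e₂∋w
          ... | inj₁ refl = q↛p₁ (q→x₁ ◅◅ walk-mono (proj₁ ∘ ∈--ᴱ⁻ (t₁ -ᴱ i) e₂) x₁→w)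
          ... | inj₂ refl = q↛p₁ (q→x₁ ◅◅ walk-mono (proj₁ ∘ ∈--ᴱ⁻ (t₁ -ᴱ i) e₂) x₁→w
                                     ◅◅ edge-path e₂∈t₁-i (Joins-sym (swap-joins sw₂)))

      swap-injective : ∀ {t₁ x₁ t₂ x₂} → Swappable t₁ x₁ → Swappable t₂ x₂ → swap p t₁ x₁ ≡ swap p t₂ x₂ →
                       t₁ ≡ t₂ × x₁ ≡ x₂
      swap-injective {t₁} {x₁} {t₂} {x₂} sw₁@(swappable _ i∈t₁ _) sw₂@(swappable _ i∈t₂ _) eq
        with x₁ ≟ x₂
      ... | no  x₁≢x₂ = ⊥-elim (distinct-ends-impossible sw₁ sw₂ x₁≢x₂ eq)
      ... | yes refl  = t₁≡t₂ , refl
        where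
        e : Edge n
        e = edgeBetween i p x₁
        outside : ∀ {t} → Swappable t x₁ → ¬ e ∈ᴱ t -ᴱ i
        outside sw@(swappable tree i∈t q→x) = reconnecting-edge-∉ tree i∈t i-pq (swap-joins sw) q→x
        t₁-i≡t₂-i : t₁ -ᴱ i ≡ t₂ -ᴱ i
        t₁-i≡t₂-i = trans (sym (+ᴱ--ᴱ (outside sw₁))) (trans (cong (_-ᴱ e) eq) (+ᴱ--ᴱ (outside sw₂)))
        t₁≡t₂ : t₁ ≡ t₂
        t₁≡t₂ = trans (sym (-ᴱ-+ᴱ i∈t₁)) (trans (cong (_+ᴱ i) t₁-i≡t₂-i) (-ᴱ-+ᴱ i∈t₂))

      swap-surjective : ∀ {t′} → IsTree t′ → ∃₂ λ t x → Swappable t x × swap p t x ≡ t′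
      swap-surjective {t′} tree′ with i ∈? t′
      ... | yes i∈t′ = t′ , q , swappable tree′ i∈t′ ε ,
                       trans (cong (t′ -ᴱ i +ᴱ_) (edgeBetween-unique i i-pq)) (-ᴱ-+ᴱ i∈t′)
      ... | no  i∉t′ with e , y , e∈t′ , e-py , y→q ← last-exit (Joins⇒≢ i-pq) (IsTree.isConnected tree′ p q) =
        t′ -ᴱ e +ᴱ i , y , swappable (exchange tree′ e∈t′ e-py i-pq y→q) (∈-+ᴱ-new (t′ -ᴱ e) i) q→y , swapped
        where
        i∉t′-e : ¬ i ∈ᴱ t′ -ᴱ e
        i∉t′-e = i∉t′ ∘ proj₁ ∘ ∈--ᴱ⁻ t′ e
        restored : t′ -ᴱ e +ᴱ i -ᴱ i ≡ t′ -ᴱ e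
        restored = +ᴱ--ᴱ i∉t′-e
        q→y : Path (t′ -ᴱ e +ᴱ i -ᴱ i) q y
        q→y = subst (λ H → Path H q y) (sym restored) (walk-reverse y→q)
        swapped : swap p (t′ -ᴱ e +ᴱ i) y ≡ t′
        swapped = trans (cong₂ _+ᴱ_ restored (edgeBetween-unique i e-py)) (-ᴱ-+ᴱ e∈t′)

  module _ (i : Edge n) {E : EdgeSet n → Bool} (E-away : AwayFrom i E) where

    private
      a b : Fin n
      a = proj₁ (ends {n} i)
      b = proj₂ (ends {n} i)

      from to : Bool → Fin n
      from true  = a
      from false = b
      to true  = b
      to false = a

      i-joins : ∀ s → Joins i (from s) (to s)
      i-joins true  = inj₁ refl
      i-joins false = inj₂ refl

      side : EdgeSet n → Fin n → Bool
      side t x = reach {n} (t -ᴱ i) n b x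

      classify : ∀ {t} → IsTree t → i ∈ᴱ t → ∀ x → Swappable i (i-joins (side t x)) t x
      classify {t} tree@(isTree conn _) i∈t x with side t x in x-on-b
      ... | true  = swappable tree i∈t (reach⇒Path (t -ᴱ i) n x-on-b)
      ... | false with Connected⇒reaches-ends conn (i-joins true) x
      ...   | inj₁ x→a = swappable tree i∈t (walk-reverse x→a)
      ...   | inj₂ x→b = ⊥-elim (not-¬ (Path⇒reach (t -ᴱ i) (walk-reverse x→b)) x-on-b)

      side-of : ∀ {s t x} → Swappable i (i-joins s) t x → side t x ≡ s
      side-of {true}  {t} (swappable _ _ b→x)      = Path⇒reach (t -ᴱ i) b→x
      side-of {false} {t} (swappable tree i∈t a→x) = ¬-not λ x-on-b →
        tree-edge-separates tree i∈t (i-joins true) (a→x ◅◅ walk-reverse (reach⇒Path (t -ᴱ i) n x-on-b))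

      φ : EdgeSet n × Fin n → EdgeSet n × Bool
      φ (t , x) = swap i (from (side t x)) t x , side t x

      tagged-swap-injective : ∀ {s₁ s₂ t₁ t₂ x₁ x₂} →
                              Swappable i (i-joins s₁) t₁ x₁ → Swappable i (i-joins s₂) t₂ x₂ →
                              (swap i (from s₁) t₁ x₁ , s₁) ≡ (swap i (from s₂) t₂ x₂ , s₂) →
                              (t₁ , x₁) ≡ (t₂ , x₂)
      tagged-swap-injective {s₁} sw₁ sw₂ eq with refl ← cong proj₂ eq =
        uncurry (cong₂ _,_) (swap-injective i (i-joins s₁) sw₁ sw₂ (cong proj₁ eq))

      Dom : List (EdgeSet n × Fin n)
      Dom = cartesianProduct (satisfying (λ t → A {n} i t ∧ E t) (spanningTrees n)) (allFin n)

      Cod : List (EdgeSet n × Bool)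
      Cod = cartesianProduct (satisfying E (spanningTrees n)) (true ∷ false ∷ [])

      ∈-Dom⁺ : ∀ {t} x → IsTree t → i ∈ᴱ t → E t ≡ true → (t , x) ∈ Dom
      ∈-Dom⁺ x tree i∈t Et =
        ∈-cartesianProduct⁺ (∈-filter⁺ (λ t → A {n} i t ∧ E t ≟ᵇ true) (∈-spanningTrees⁺ tree)
                                       (cong₂ _∧_ ([]=⇒lookup i∈t) Et))
                            (∈-allFin x)

      ∈-Dom⁻ : ∀ {t x} → (t , x) ∈ Dom → IsTree t × i ∈ᴱ t × E t ≡ true
      ∈-Dom⁻ {t} z∈ with t∈ , _ ← ∈-cartesianProduct⁻ _ _ z∈
                with t∈ST , h ← ∈-filter⁻ (λ t → A {n} i t ∧ E t ≟ᵇ true) {xs = spanningTrees n} t∈ =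
        ∈-spanningTrees⁻ t∈ST , lookup⇒[]= i t (∧-conicalˡ _ _ h) , ∧-conicalʳ _ _ h

      ∈-Cod⁺ : ∀ {t} → IsTree t → E t ≡ true → ∀ s → (t , s) ∈ Cod
      ∈-Cod⁺ tree Et s =
        ∈-cartesianProduct⁺ (∈-filter⁺ (λ t → E t ≟ᵇ true) (∈-spanningTrees⁺ tree) Et) (∈-bools s)
        where
        ∈-bools : ∀ s → s ∈ true ∷ false ∷ []
        ∈-bools true  = here refl
        ∈-bools false = there (here refl)

      ∈-Cod⁻ : ∀ {t s} → (t , s) ∈ Cod → IsTree t × E t ≡ true
      ∈-Cod⁻ w∈ with t∈ , _ ← ∈-cartesianProduct⁻ _ _ w∈
                with t∈ST , Et ← ∈-filter⁻ (λ t → E t ≟ᵇ true) {xs = spanningTrees n} t∈ =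
        ∈-spanningTrees⁻ t∈ST , Et

      φ-into : ∀ {z} → z ∈ Dom → φ z ∈ Cod
      φ-into {t , x} z∈ with tree , i∈t , Et ← ∈-Dom⁻ z∈ =
        let sw = classify tree i∈t x in
        ∈-Cod⁺ (swap-IsTree i _ sw) (trans (swap-preserves i _ E-away sw) Et) (side t x)

      φ-injective : ∀ {z₁ z₂} → z₁ ∈ Dom → z₂ ∈ Dom → φ z₁ ≡ φ z₂ → z₁ ≡ z₂
      φ-injective {t₁ , x₁} {t₂ , x₂} z₁∈ z₂∈ =
        let tree₁ , i∈t₁ , _ = ∈-Dom⁻ z₁∈
            tree₂ , i∈t₂ , _ = ∈-Dom⁻ z₂∈
        in tagged-swap-injective {side t₁ x₁} {side t₂ x₂} (classify tree₁ i∈t₁ x₁) (classify tree₂ i∈t₂ x₂)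

      φ-onto : ∀ {w} → w ∈ Cod → ∃ λ z → z ∈ Dom × φ z ≡ w
      φ-onto {t′ , s} w∈ with tree′ , Et′ ← ∈-Cod⁻ w∈
                         with t , x , sw@(swappable tree i∈t _) , swapped ← swap-surjective i (i-joins s) tree′ =
        (t , x) ,
        ∈-Dom⁺ x tree i∈t (trans (sym (swap-preserves i _ E-away sw)) (trans (cong E swapped) Et′)) ,
        trans (cong (λ s → swap i (from s) t x , s) (side-of sw)) (cong (_, s) swapped)

    count[A∧E]*n≡count[E]*2 : count (spanningTrees n) (λ t → A {n} i t ∧ E t) * n ≡ count (spanningTrees n) E * 2
    count[A∧E]*n≡count[E]*2 = begin
      length ST[A∧E] * n                  ≡⟨ cong (length ST[A∧E] *_) (length-tabulate id) ⟨
      length ST[A∧E] * length (allFin n)  ≡⟨ length-cartesianProduct ST[A∧E] (allFin n) ⟨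
      length Dom                          ≡⟨ length-≡-by-bijection Dom-unique Cod-unique φ φ-into φ-injective φ-onto ⟩
      length Cod                          ≡⟨ length-cartesianProduct ST[E] (true ∷ false ∷ []) ⟩
      length ST[E] * 2                    ∎
      where
      open ≡-Reasoning
      ST[A∧E] ST[E] : List (EdgeSet n)
      ST[A∧E] = satisfying (λ t → A {n} i t ∧ E t) (spanningTrees n)
      ST[E]   = satisfying E (spanningTrees n)
      Dom-unique : Unique Dom
      Dom-unique = Unique.cartesianProduct⁺ (Unique.filter⁺ (λ t → A {n} i t ∧ E t ≟ᵇ true) spanningTrees-unique)
                                            (Unique.allFin⁺ n)
      Cod-unique : Unique Cod
      Cod-unique = Unique.cartesianProduct⁺ (Unique.filter⁺ (λ t → E t ≟ᵇ true) spanningTrees-unique)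
                                            (((λ ()) All.∷ All.[]) ∷ All.[] ∷ [])

  count[A]*n≡length*2 : ∀ (i : Edge n) → count (spanningTrees n) (A {n} i) * n ≡ length (spanningTrees n) * 2
  count[A]*n≡length*2 i = begin
    count ST (A {n} i) * n                 ≡⟨ cong (_* n) (count-cong ST (λ t → ∧-identityʳ (A {n} i t))) ⟨
    count ST (λ t → A {n} i t ∧ true) * n  ≡⟨ count[A∧E]*n≡count[E]*2 i (λ _ _ _ → refl) ⟩
    count ST (λ _ → true) * 2              ≡⟨ cong (λ ts → length ts * 2)
                                                   (filter-all (λ _ → true ≟ᵇ true) (All.universal (λ _ → refl) ST)) ⟩
    length ST * 2                          ∎
    where
    open ≡-Reasoning
    ST : List (EdgeSet n)
    ST = spanningTrees n

  PrCond[A|E]≤Pr[A] : ∀ (i : Edge n) {E} → AwayFrom i E →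
                      PrCond (spanningTrees n) (A {n} i) E ℚ.≤ Pr (spanningTrees n) (A {n} i)
  PrCond[A|E]≤Pr[A] i {E} E-away =
    frac-cross-≤ (length-filter (λ t → E t ≟ᵇ true) ST)
      (cross-multiply {count ST (λ t → A {n} i t ∧ E t)} {count ST (A {n} i)} {count ST E} {length ST} {n} {2}
                      (count[A∧E]*n≡count[E]*2 i E-away) (count[A]*n≡length*2 i))
    where
    ST : List (EdgeSet n)
    ST = spanningTrees n

  lineAdj≡false⇒¬Meets : ∀ {i j : Edge n} → i ≢ j → lineAdj {n} i j ≡ false → ¬ Meets i j
  lineAdj≡false⇒¬Meets {i} {j} i≢j adj≡false (w , i∋w , j∋w) = apart i∋w j∋w
    where
    a b x y : Fin n
    a = proj₁ (ends {n} i)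
    b = proj₂ (ends {n} i)
    x = proj₁ (ends {n} j)
    y = proj₂ (ends {n} j)
    shares : eqF a x ∨ eqF a y ∨ eqF b x ∨ eqF b y ≡ false
    shares = trans (sym (cong (λ c → not c ∧ (eqF a x ∨ eqF a y ∨ eqF b x ∨ eqF b y)) (≢⇒eqF≡false i≢j)))
                   adj≡false
    ax≡false : eqF a x ≡ false
    ax≡false = ∨-conicalˡ (eqF a x) _ shares
    ay≡false : eqF a y ≡ false
    ay≡false = ∨-conicalˡ (eqF a y) _ (∨-conicalʳ (eqF a x) _ shares)
    bx≡false : eqF b x ≡ false
    bx≡false = ∨-conicalˡ (eqF b x) _ (∨-conicalʳ (eqF a y) _ (∨-conicalʳ (eqF a x) _ shares))
    by≡false : eqF b y ≡ false
    by≡false = ∨-conicalʳ (eqF b x) _ (∨-conicalʳ (eqF a y) _ (∨-conicalʳ (eqF a x) _ shares))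
    ≢w : ∀ {u v : Fin n} → eqF u v ≡ false → u ≡ w → v ≡ w → ⊥
    ≢w uv≡false u≡w v≡w = eqF≡false⇒≢ uv≡false (trans u≡w (sym v≡w))
    apart : Touches i w → Touches j w → ⊥
    apart (inj₁ a≡w) (inj₁ x≡w) = ≢w ax≡false a≡w x≡w
    apart (inj₁ a≡w) (inj₂ y≡w) = ≢w ay≡false a≡w y≡w
    apart (inj₂ b≡w) (inj₁ x≡w) = ≢w bx≡false b≡w x≡w
    apart (inj₂ b≡w) (inj₂ y≡w) = ≢w by≡false b≡w y≡w

  module _ {i : Edge n} {S : Subset (m n)} where

    noneOf-AwayFrom : i ∉ˢ S → (∀ j → j ∈ˢ S → lineAdj {n} i j ≡ false) → AwayFrom i (noneOf (A {n}) S)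
    noneOf-AwayFrom i∉S S≁i t t′ agree = cong and (map-cong same-conjunct (allFin (m n)))
      where
      same-conjunct : ∀ j → not (Vec.lookup S j ∧ A {n} j t) ≡ not (Vec.lookup S j ∧ A {n} j t′)
      same-conjunct j with Vec.lookup S j in j∈S
      ... | false = refl
      ... | true  = cong not (agree j (lineAdj≡false⇒¬Meets i≢j (S≁i j (lookup⇒[]= j S j∈S))))
        where
        i≢j : i ≢ j
        i≢j refl = i∉S (lookup⇒[]= i S j∈S)

    noneOf-excludes : i ∈ˢ S → ∀ t → A {n} i t ∧ noneOf (A {n}) S t ≡ false
    noneOf-excludes i∈S t with A {n} i t in i∈t
    ... | false = refl
    ... | true  = ¬-not λ none →
      case trans (sym (all≡true⁻ (λ j → not (Vec.lookup S j ∧ A {n} j t)) none (∈-allFin i)))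
                 (cong₂ (λ x y → not (x ∧ y)) ([]=⇒lookup i∈S) i∈t) of λ ()

corollary3p4 : (n : ℕ) (T : EdgeSet n) → isSpanningTree {n} T ≡ true →
    IsNegDepGraph (spanningTrees n) T (A {n}) (lineAdj {n})
corollary3p4 n _ _ i _ S _ S≁i _ with i ∈? S
... | yes i∈S = disjoint⇒PrCond≤Pr (spanningTrees n) (A {n} i) (noneOf (A {n}) S) (noneOf-excludes {n} i∈S)
... | no  i∉S = PrCond[A|E]≤Pr[A] {n} i (noneOf-AwayFrom {n} i∉S S≁i)
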